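{- Every prime 3-colorable co-bridge-free prismatic graph has a hitting set of the triangles of size at most $5$.
   Context: A triangle is a set of three pairwise adjacent vertices; $G$ is prismatic if for every triangle $T$ every vertex not in $T$ has exactly one neighbor in $T$. The co-bridge is $C_4+2K_1$; co-bridge-free means no induced co-bridge. A hitting set is a set of vertices meeting every triangle. A 3-colored graph is a quadruple $(G,A,B,C)$ where $A,B,C$ are stable sets partitioning $V(G)$. A 3-colorable prismatic graph is prime if (with some 3-coloring) it belongs to $\mathcal Q_0\cup\mathcal Q_1\cup\mathcal Q_2$, where $\mathcal Q_0$ is the class of 3-colored graphs with no triangle, $\mathcal Q_1$ is the class of 3-colored graphs isomorphic to $L(K_{3,3})$ (the line graph of $K_{3,3}$), and $\mathcal Q_2$ is the class of canonically-colored path of triangles graphs. Here: sets $X,Y$ are complete (anticomplete) if every vertex of $X$ is adjacent (non-adjacent) to every vertex of $Y$; matched if disjoint, $|X|=|Y|$, and each vertex of either has a unique neighbor in the other. $G$ is a path of triangles graph if for some $n\ge1$ there is a partition of $V(G)$ into stable sets $X_1,\dots,X_{2n+1}$ with: P1: for $1\le i\le n$ a nonempty $\hat X_{2i}\subseteq X_{2i}$, at least one of $\hat X_{2i},\hat X_{2i+2}$ of cardinality 1; P2: for $1\le i<j\le 2n+1$: (1) if $j-i\equiv2\pmod3$ and some $u\in X_i$, $v\in X_j$ are non-adjacent, then either $i,j$ odd and $j=i+2$, or $i,j$ even and $u\notin\hat X_i$, $v\notin\hat X_j$; (2) if $j-i\not\equiv 2\pmod3$ then $j=i+1$ or $X_i$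 is anticomplete to $X_j$; P3: for $1\le i\le n+1$, $X_{2i-1}=L_{2i-1}\cup M_{2i-1}\cup R_{2i-1}$ pairwise disjoint; P4: for $1\le i\le n$, $X_{2i}$ anticomplete to $L_{2i-1}\cup R_{2i+1}$; $X_{2i}\setminus\hat X_{2i}$ anticomplete to $M_{2i-1}\cup M_{2i+1}$; every vertex of $X_{2i}\setminus\hat X_{2i}$ adjacent to exactly one end of every edge between $R_{2i-1}$ and $L_{2i+1}$; P5: for $1\le i\le n$ with $|\hat X_{2i}|=1$: (1) $R_{2i-1},L_{2i+1}$ matched and every edge between $M_{2i-1}\cup R_{2i-1}$ and $L_{2i+1}\cup M_{2i+1}$ is between $R_{2i-1}$ and $L_{2i+1}$; (2) the vertex of $\hat X_{2i}$ is complete to $R_{2i-1}\cup M_{2i-1}\cup L_{2i+1}\cup M_{2i+1}$; (3) $L_{2i-1}$ complete to $X_{2i+1}$ and $X_{2i-1}$ complete to $R_{2i+1}$; (4) if $i>1$, $M_{2i-1},\hat X_{2i-2}$ matched; if $i<n$, $M_{2i+1},\hat X_{2i+2}$ matched; P6: for $1\le i\le n$ with $|\hat X_{2i}|>1$: (1) $R_{2i-1}=L_{2i+1}=\emptyset$; (2) $u\in X_{2i-1}$, $v\in X_{2i+1}$ are non-adjacent iff they have the same neighbor in $\hat X_{2i}$; P7: (1) $|\hat X_2|=|\hat X_{2n}|=1$; (2) $L_1=M_1=M_{2n+1}=R_{2n+1}=\emptyset$; (3) if $R_1=\emptyset$ then $n\ge2$ and $|\hat X_4|>1$; if $L_{2n+1}=\emptyset$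 then $n\ge 2$ and $|\hat X_{2n-2}|>1$. Such a partition is a good partition. For $k=0,1,2$ let $A_k=\bigcup\{X_i: 1\le i\le 2n+1,\ i\equiv k\pmod 3\}$. A 3-colored graph $(G,A,B,C)$ is a canonically-colored path of triangles graph if $G$ has a good partition with $\{A_0,A_1,A_2\}=\{A,B,C\}$. -}

module Defs where

open import Data.Nat using (ℕ; zero; suc; _+_; _*_; _∸_; _≤_; _<_; _%_; _≡ᵇ_)
open import Data.Bool using (Bool; true; false; _∧_; _∨_; not; T)
open import Data.Fin using (Fin; toℕ)
open import Data.Fin.Subset using (∣_∣)
open import Data.Vec using (tabulate)
open import Data.Product using (Σ; ∃; _×_; _,_)
open import Data.Sum using (_⊎_)
open import Relation.Nullary using (¬_)
open import Relation.Binary.PropositionalEquality using (_≡_; _≢_)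
open import Function.Bundles using (_↔_; _⇔_; Inverse)

record Graph (N : ℕ) : Set where
  field
    adj        : Fin N → Fin N → Bool
    adj-sym    : ∀ u v → adj u v ≡ adj v u
    adj-irrefl : ∀ v → adj v v ≡ false

VSet : ℕ → Set
VSet N = Fin N → Bool

_∈ᵥ_ : ∀ {N} → Fin N → VSet N → Set
v ∈ᵥ P = T (P v)

_∪ᵥ_ : ∀ {N} → VSet N → VSet N → VSet N
(P ∪ᵥ Q) v = P v ∨ Q v

infixr 6 _∪ᵥ_
infix 4 _∈ᵥ_

card : ∀ {N} → VSet N → ℕ
card P = ∣ tabulate P ∣

Empty : ∀ {N} → VSet N → Set
Empty X = ∀ v → ¬ (v ∈ᵥ X)

b2n : Bool → ℕ
b2n true  = 1
b2n false = 0

-- The co-bridge C4 + 2K1 on vertices 0..5: the 4-cycle 0-1-2-3-0, and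
-- 4, 5 isolated.

cbEdge : ℕ → ℕ → Bool
cbEdge 0 1 = true
cbEdge 1 0 = true
cbEdge 1 2 = true
cbEdge 2 1 = true
cbEdge 2 3 = true
cbEdge 3 2 = true
cbEdge 3 0 = true
cbEdge 0 3 = true
cbEdge _ _ = false

coBridgeAdj : Fin 6 → Fin 6 → Bool
coBridgeAdj i j = cbEdge (toℕ i) (toℕ j)

-- L(K_{3,3}): vertices are the edges (a , b) of K_{3,3}
-- (a in the left side, b in the right side); two distinct edges are
-- adjacent iff they share an endpoint.

LK33V : Set
LK33V = Fin 3 × Fin 3

LK33Adj : LK33V → LK33V → Set
LK33Adj (a , b) (c , d) = (a ≡ c ⊎ b ≡ d) × ¬ (a ≡ c × b ≡ d)

data Side : Set where
  L M R : Side

isL isM isR : Side → Bool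
isL L = true
isL _ = false
isM M = true
isM _ = false
isR R = true
isR _ = false

module _ {N : ℕ} (G : Graph N) where
  open Graph G

  Adj : Fin N → Fin N → Set
  Adj u v = T (adj u v)

  Triangle : Fin N → Fin N → Fin N → Set
  Triangle a b c = Adj a b × Adj b c × Adj a c

  Prismatic : Set
  Prismatic = ∀ a b c → Triangle a b c → ∀ v → v ≢ a → v ≢ b → v ≢ c →
              b2n (adj v a) + b2n (adj v b) + b2n (adj v c) ≡ 1

  CoBridgeFree : Set
  CoBridgeFree = ¬ (Σ (Fin 6 → Fin N) λ f →
                      (∀ i j → f i ≡ f j → i ≡ j) ×
                      (∀ i j → adj (f i) (f j) ≡ coBridgeAdj i j))

  HittingSet : VSet N → Set
  HittingSet S = ∀ a b c → Triangle a b c → (a ∈ᵥ S) ⊎ (b ∈ᵥ S) ⊎ (c ∈ᵥ S)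

  Complete : VSet N → VSet N → Set
  Complete X Y = ∀ u v → u ∈ᵥ X → v ∈ᵥ Y → Adj u v

  Anticomplete : VSet N → VSet N → Set
  Anticomplete X Y = ∀ u v → u ∈ᵥ X → v ∈ᵥ Y → ¬ Adj u v

  UniqueNbr : Fin N → VSet N → Set
  UniqueNbr u Y = ∃ λ w → (w ∈ᵥ Y) × Adj u w × (∀ w' → w' ∈ᵥ Y → Adj u w' → w' ≡ w)

  Matched : VSet N → VSet N → Set
  Matched X Y = (∀ v → v ∈ᵥ X → ¬ (v ∈ᵥ Y)) × card X ≡ card Y ×
                (∀ u → u ∈ᵥ X → UniqueNbr u Y) × (∀ u → u ∈ᵥ Y → UniqueNbr u X)

  -- a 3-coloring col encodes the 3-colored graph (G, col⁻¹ 0, col⁻¹ 1, col⁻¹ 2)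
  ProperColoring : (Fin N → Fin 3) → Set
  ProperColoring col = ∀ u v → Adj u v → col u ≢ col v

  ThreeColorable : Set
  ThreeColorable = ∃ ProperColoring

  NoTriangle : Set
  NoTriangle = ∀ a b c → ¬ Triangle a b c

  IsoLK33 : Set
  IsoLK33 = Σ (Fin N ↔ LK33V) λ φ →
              ∀ u v → Adj u v ⇔ LK33Adj (Inverse.to φ u) (Inverse.to φ v)

  -- Good partitions.  idx v = i means v ∈ X_i; hat v (for v in an even
  -- part X_{2i}) means v ∈ X̂_{2i}; side v (for v in an odd part) says
  -- whether v ∈ L, M or R of that part.

  module _ (idx : Fin N → ℕ) (hat : Fin N → Bool) (side : Fin N → Side) where

    X : ℕ → VSet N
    X k v = idx v ≡ᵇ k

    Xh : ℕ → VSet N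
    Xh k v = X k v ∧ hat v

    Xnh : ℕ → VSet N
    Xnh k v = X k v ∧ not (hat v)

    Ls Ms Rs : ℕ → VSet N
    Ls k v = X k v ∧ isL (side v)
    Ms k v = X k v ∧ isM (side v)
    Rs k v = X k v ∧ isR (side v)

    Odd Even : ℕ → Set
    Odd i = i % 2 ≡ 1
    Even i = i % 2 ≡ 0

    record IsGoodPartition (n : ℕ) : Set where
      field
        n≥1    : 1 ≤ n
        range  : ∀ v → 1 ≤ idx v × idx v ≤ 2 * n + 1
        stable : ∀ k → Anticomplete (X k) (X k)
        P1-nonempty : ∀ i → 1 ≤ i → i ≤ n → 1 ≤ card (Xh (2 * i))
        P1-one      : ∀ i → 1 ≤ i → i < n →
                      card (Xh (2 * i)) ≡ 1 ⊎ card (Xh (2 * i + 2)) ≡ 1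
        P2-1 : ∀ i j → 1 ≤ i → i < j → j ≤ 2 * n + 1 → (j ∸ i) % 3 ≡ 2 →
               ∀ u v → u ∈ᵥ X i → v ∈ᵥ X j → ¬ Adj u v →
               (Odd i × Odd j × j ≡ i + 2) ⊎
               (Even i × Even j × ¬ (u ∈ᵥ Xh i) × ¬ (v ∈ᵥ Xh j))
        P2-2 : ∀ i j → 1 ≤ i → i < j → j ≤ 2 * n + 1 → ¬ ((j ∸ i) % 3 ≡ 2) →
               j ≡ i + 1 ⊎ Anticomplete (X i) (X j)
        -- P3 is built in: side partitions each odd part into L, M, R.
        -- P4
        P4-1 : ∀ i → 1 ≤ i → i ≤ n →
               Anticomplete (X (2 * i)) (Ls (2 * i ∸ 1) ∪ᵥ Rs (2 * i + 1))
        P4-2 : ∀ i → 1 ≤ i → i ≤ n →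
               Anticomplete (Xnh (2 * i)) (Ms (2 * i ∸ 1) ∪ᵥ Ms (2 * i + 1))
        P4-3 : ∀ i → 1 ≤ i → i ≤ n → ∀ w a b →
               w ∈ᵥ Xnh (2 * i) → a ∈ᵥ Rs (2 * i ∸ 1) → b ∈ᵥ Ls (2 * i + 1) →
               Adj a b → (Adj w a × ¬ Adj w b) ⊎ (¬ Adj w a × Adj w b)
        P5-1a : ∀ i → 1 ≤ i → i ≤ n → card (Xh (2 * i)) ≡ 1 →
                Matched (Rs (2 * i ∸ 1)) (Ls (2 * i + 1))
        P5-1b : ∀ i → 1 ≤ i → i ≤ n → card (Xh (2 * i)) ≡ 1 → ∀ a b →
                a ∈ᵥ (Ms (2 * i ∸ 1) ∪ᵥ Rs (2 * i ∸ 1)) →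
                b ∈ᵥ (Ls (2 * i + 1) ∪ᵥ Ms (2 * i + 1)) → Adj a b →
                a ∈ᵥ Rs (2 * i ∸ 1) × b ∈ᵥ Ls (2 * i + 1)
        P5-2  : ∀ i → 1 ≤ i → i ≤ n → card (Xh (2 * i)) ≡ 1 →
                Complete (Xh (2 * i))
                  (Rs (2 * i ∸ 1) ∪ᵥ Ms (2 * i ∸ 1) ∪ᵥ Ls (2 * i + 1) ∪ᵥ Ms (2 * i + 1))
        P5-3a : ∀ i → 1 ≤ i → i ≤ n → card (Xh (2 * i)) ≡ 1 →
                Complete (Ls (2 * i ∸ 1)) (X (2 * i + 1))
        P5-3b : ∀ i → 1 ≤ i → i ≤ n → card (Xh (2 * i)) ≡ 1 →
                Complete (X (2 * i ∸ 1)) (Rs (2 * i + 1))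
        P5-4a : ∀ i → 1 ≤ i → i ≤ n → card (Xh (2 * i)) ≡ 1 → 1 < i →
                Matched (Ms (2 * i ∸ 1)) (Xh (2 * i ∸ 2))
        P5-4b : ∀ i → 1 ≤ i → i ≤ n → card (Xh (2 * i)) ≡ 1 → i < n →
                Matched (Ms (2 * i + 1)) (Xh (2 * i + 2))
        P6-1 : ∀ i → 1 ≤ i → i ≤ n → 1 < card (Xh (2 * i)) →
               Empty (Rs (2 * i ∸ 1)) × Empty (Ls (2 * i + 1))
        P6-2 : ∀ i → 1 ≤ i → i ≤ n → 1 < card (Xh (2 * i)) → ∀ u v →
               u ∈ᵥ X (2 * i ∸ 1) → v ∈ᵥ X (2 * i + 1) →
               ((¬ Adj u v) ⇔ (∃ λ w → w ∈ᵥ Xh (2 * i) × Adj w u × Adj w v))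
        P7-1 : card (Xh 2) ≡ 1 × card (Xh (2 * n)) ≡ 1
        P7-2 : Empty (Ls 1) × Empty (Ms 1) × Empty (Ms (2 * n + 1)) × Empty (Rs (2 * n + 1))
        P7-3a : Empty (Rs 1) → 2 ≤ n × 1 < card (Xh 4)
        P7-3b : Empty (Ls (2 * n + 1)) → 2 ≤ n × 1 < card (Xh (2 * n ∸ 2))

    -- {A_0, A_1, A_2} = {col⁻¹ 0, col⁻¹ 1, col⁻¹ 2} as sets of vertex sets,
    -- where A_k = ⋃ { X_i : i ≡ k mod 3 }.
    Canonical : (Fin N → Fin 3) → Set
    Canonical col =
      (∀ (k : Fin 3) → ∃ λ (c : Fin 3) → ∀ v → (idx v % 3 ≡ toℕ k) ⇔ (col v ≡ c)) ×
      (∀ (c : Fin 3) → ∃ λ (k : Fin 3) → ∀ v → (idx v % 3 ≡ toℕ k) ⇔ (col v ≡ c))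

  CanonPathOfTriangles : (Fin N → Fin 3) → Set
  CanonPathOfTriangles col =
    ∃ λ (n : ℕ) → ∃ λ (idx : Fin N → ℕ) → ∃ λ (hat : Fin N → Bool) →
    ∃ λ (side : Fin N → Side) →
      IsGoodPartition idx hat side n × Canonical idx hat side col

  Prime : Set
  Prime = ∃ λ (col : Fin N → Fin 3) → ProperColoring col ×
            (NoTriangle ⊎ IsoLK33 ⊎ CanonPathOfTriangles col)

{-# OPTIONS --safe #-}
-- A triangle-free graph needs no vertex, and the three edges (k , k) of K₃,₃ meet every
-- triangle of L(K₃,₃).  In a path of triangles, P2 allows edges only between parts at
-- distance 1 or ≡ 2 (mod 3), so every triangle lies in three consecutive parts, and P4–P6
-- force it to contain the vertex of a singleton hat X̂₂ᵢ.  The at most n singleton hats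
-- therefore hit every triangle, which settles n ≤ 5.  For n = 6 one hat can be dropped:
-- a hat that is not a singleton, or else X̂₄, because then R₃ = ∅ (otherwise R₁, R₃, X̂₄,
-- X̂₆, X₁₀, X₁₃ contain an induced co-bridge) and every triangle at X̂₄ also meets X̂₂ or
-- X̂₆.  For n ≥ 7 the parts X₁, …, X₁₅ always contain an induced co-bridge.
module Submission where

open import Defs hiding (X; Xh; Xnh; Ls; Ms; Rs)
open import Data.Nat using (ℕ; _≤_)
open import Data.Product using (∃; _×_)

open import Data.Bool using (Bool; true; false; _∧_; _∨_; T)
import Data.Bool.Properties as Bool
open import Data.Empty using (⊥-elim)
open import Data.Fin using (Fin; zero; suc)
open import Data.Fin.Patterns using (0F; 1F; 2F; 3F; 4F; 5F)
import Data.Fin.Properties as Fin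
open import Data.Fin.Subset using (∣_∣)
open import Data.List using (List; []; _∷_; foldr; length; allFin; applyUpTo; filter)
open import Data.List.Membership.Propositional using (_∈_; find)
open import Data.List.Membership.Propositional.Properties using (∈-allFin; ∈-applyUpTo⁺; ∈-filter⁺)
open import Data.List.Properties using (length-applyUpTo; filter-notAll)
open import Data.List.Relation.Unary.All as All using (All)
open import Data.List.Relation.Unary.All.Properties using (¬All⇒Any¬)
open import Data.List.Relation.Unary.Any as Any using (here; there)
import Data.Nat as ℕ
open import Data.Nat using (zero; suc; _+_; _*_; _∸_; _%_; ∣_-_∣; _<_; z≤n; s≤s; s≤s⁻¹)
open import Data.Nat.DivMod using (%-distribˡ-+; m*n%n≡0)
open import Data.Nat.Properties
  using ( ≤-refl; ≤-trans; ≤-reflexive; ≤-antisym; <⇒≤; <⇒≢; ≮⇒≥; ≰⇒>; ≤∧≢⇒<; 1+n≰n; <-cmp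
        ; +-assoc; +-comm; +-suc; *-comm; *-suc; +-mono-≤; *-monoʳ-≤; m≤m+n; m<m+n; suc-injective
        ; m+n∸m≡n; m<n⇒0<n∸m; m≤n⇒∃[o]m+o≡n; ∣m-m+n∣≡n; m≤n⇒∣m-n∣≡n∸m; m≤n⇒∣n-m∣≡n∸m
        ; ≡ᵇ⇒≡; ≡⇒≡ᵇ; +-commutativeSemigroup; module ≤-Reasoning )
open import Algebra.Properties.CommutativeSemigroup +-commutativeSemigroup using (interchange)
open import Data.Product using (_,_; proj₁; proj₂; ∃₂; uncurry)
import Data.Product as Product
open import Data.Sum using (_⊎_; inj₁; inj₂; [_,_]; [_,_]′)
import Data.Sum as Sum
open import Data.Unit using (tt)
open import Data.Vec.Properties using (tabulate-cong)
open import Function using (_∘_; id; case_of_; Inverse; Equivalence)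
open import Relation.Binary.Definitions using (tri<; tri≈; tri>)
open import Relation.Binary.PropositionalEquality using (_≡_; _≢_; refl; sym; trans; cong; cong₂; subst; subst₂)
open import Relation.Nullary using (¬_; Dec; yes; no)
open import Relation.Nullary.Decidable
  using (True; False; ⌊_⌋; toWitness; fromWitness; toWitnessFalse; decidable-stable; from-yes
        ; ¬?; T?; _×-dec_; _⊎-dec_; _→-dec_)

private
  variable
    N : ℕ
    P Q : VSet N
    u v w : Fin N

∅ᵥ : VSet N
∅ᵥ _ = false

⁅_⁆ᵥ : Fin N → VSet N
⁅ w ⁆ᵥ v = ⌊ v Fin.≟ w ⌋

⋃ᵥ : ∀ {A : Set} → List A → (A → VSet N) → VSet N
⋃ᵥ I F = foldr (λ i S → F i ∪ᵥ S) ∅ᵥ I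

∪ᵥ-introˡ : ∀ (P Q : VSet N) → v ∈ᵥ P → v ∈ᵥ P ∪ᵥ Q
∪ᵥ-introˡ P Q v∈P = Equivalence.from Bool.T-∨ (inj₁ v∈P)

∪ᵥ-introʳ : ∀ (P Q : VSet N) → v ∈ᵥ Q → v ∈ᵥ P ∪ᵥ Q
∪ᵥ-introʳ P Q v∈Q = Equivalence.from Bool.T-∨ (inj₂ v∈Q)

∪ᵥ-elim : ∀ (P Q : VSet N) → v ∈ᵥ P ∪ᵥ Q → v ∈ᵥ P ⊎ v ∈ᵥ Q
∪ᵥ-elim P Q = Equivalence.to Bool.T-∨

∈-⋃ᵥ : ∀ {A : Set} {I : List A} {i} (F : A → VSet N) → i ∈ I → v ∈ᵥ F i → v ∈ᵥ ⋃ᵥ I F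
∈-⋃ᵥ {I = j ∷ I} F (here refl) v∈ = ∪ᵥ-introˡ (F j) (⋃ᵥ I F) v∈
∈-⋃ᵥ {I = j ∷ I} F (there i∈I) v∈ = ∪ᵥ-introʳ (F j) (⋃ᵥ I F) (∈-⋃ᵥ F i∈I v∈)

card-∅ : card (∅ᵥ {N}) ≡ 0
card-∅ {zero} = refl
card-∅ {suc N} = card-∅ {N}

card-cong : (∀ v → P v ≡ Q v) → card P ≡ card Q
card-cong P≗Q = cong ∣_∣ (tabulate-cong P≗Q)

card-suc : (P : VSet (suc N)) → card P ≡ b2n (P zero) + card (P ∘ suc)
card-suc P with P zero
... | true = refl
... | false = refl

card-∪ : (P Q : VSet N) → card (P ∪ᵥ Q) ≤ card P + card Q
card-∪ {zero} P Q = z≤n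
card-∪ {suc N} P Q = begin
  card (P ∪ᵥ Q)
    ≡⟨ card-suc (P ∪ᵥ Q) ⟩
  b2n (P zero ∨ Q zero) + card ((P ∪ᵥ Q) ∘ suc)
    ≤⟨ +-mono-≤ (b2n-∨ (P zero) (Q zero)) (card-∪ (P ∘ suc) (Q ∘ suc)) ⟩
  (b2n (P zero) + b2n (Q zero)) + (card (P ∘ suc) + card (Q ∘ suc))
    ≡⟨ interchange (b2n (P zero)) (b2n (Q zero)) (card (P ∘ suc)) (card (Q ∘ suc)) ⟩
  (b2n (P zero) + card (P ∘ suc)) + (b2n (Q zero) + card (Q ∘ suc))
    ≡⟨ sym (cong₂ _+_ (card-suc P) (card-suc Q)) ⟩
  card P + card Q ∎
  where
  open ≤-Reasoning
  b2n-∨ : ∀ x y → b2n (x ∨ y) ≤ b2n x + b2n y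
  b2n-∨ true _ = s≤s z≤n
  b2n-∨ false _ = ≤-refl

card-⋃ᵥ≤length : ∀ {A : Set} (I : List A) (F : A → VSet N) → (∀ i → card (F i) ≤ 1) → card (⋃ᵥ I F) ≤ length I
card-⋃ᵥ≤length {N} [] F _ = ≤-reflexive (card-∅ {N})
card-⋃ᵥ≤length (i ∷ I) F F≤1 = ≤-trans (card-∪ (F i) (⋃ᵥ I F)) (+-mono-≤ (F≤1 i) (card-⋃ᵥ≤length I F F≤1))

card≥1⇒nonempty : 1 ≤ card P → ∃ (_∈ᵥ P)
card≥1⇒nonempty {suc N} {P} 1≤∣P∣ with P zero in P₀
... | true = zero , Equivalence.from Bool.T-≡ P₀
... | false = let (v , v∈) = card≥1⇒nonempty {P = P ∘ suc} 1≤∣P∣ in suc v , v∈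

card>1⇒two-members : 1 < card P → ∃₂ λ v w → v ≢ w × v ∈ᵥ P × w ∈ᵥ P
card>1⇒two-members {suc N} {P} 1<∣P∣ with P zero in P₀
... | true = let (w , w∈) = card≥1⇒nonempty {P = P ∘ suc} (s≤s⁻¹ 1<∣P∣)
             in zero , suc w , (λ ()) , Equivalence.from Bool.T-≡ P₀ , w∈
... | false = let (v , w , v≢w , v∈ , w∈) = card>1⇒two-members {P = P ∘ suc} 1<∣P∣
              in suc v , suc w , v≢w ∘ Fin.suc-injective , v∈ , w∈

subsingleton⇒card≤1 : (∀ {v w} → v ∈ᵥ P → w ∈ᵥ P → v ≡ w) → card P ≤ 1
subsingleton⇒card≤1 unique = ≮⇒≥ λ 1<∣P∣ →
  let (v , w , v≢w , v∈ , w∈) = card>1⇒two-members 1<∣P∣ in v≢w (unique v∈ w∈)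

card-⁅⁆ᵥ≤1 : (w : Fin N) → card ⁅ w ⁆ᵥ ≤ 1
card-⁅⁆ᵥ≤1 w = subsingleton⇒card≤1 {P = ⁅ w ⁆ᵥ} λ u≡w v≡w → trans (toWitness u≡w) (sym (toWitness v≡w))

-- Triangles and induced co-bridges

module _ (G : Graph N) where
  open Graph G

  Adj-sym : Adj G u v → Adj G v u
  Adj-sym {u} {v} = subst T (adj-sym u v)

  Adj-irrefl : ¬ Adj G v v
  Adj-irrefl {v} = subst T (adj-irrefl v)

  Adj⇒≢ : Adj G u v → u ≢ v
  Adj⇒≢ uv refl = Adj-irrefl uv

  triangle-swap₁₂ : ∀ {a b c} → Triangle G a b c → Triangle G b a c
  triangle-swap₁₂ (ab , bc , ac) = Adj-sym ab , ac , bc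

  triangle-swap₂₃ : ∀ {a b c} → Triangle G a b c → Triangle G a c b
  triangle-swap₂₃ (ab , bc , ac) = ac , Adj-sym bc , ab

  record InducedCoBridge : Set where
    field
      v₀ v₁ v₂ v₃ v₄ v₅ : Fin N
      v₀v₁ : Adj G v₀ v₁
      v₁v₂ : Adj G v₁ v₂
      v₂v₃ : Adj G v₂ v₃
      v₃v₀ : Adj G v₃ v₀
      v₀≁v₂ : ¬ Adj G v₀ v₂
      v₁≁v₃ : ¬ Adj G v₁ v₃
      v₀≁v₄ : ¬ Adj G v₀ v₄
      v₀≁v₅ : ¬ Adj G v₀ v₅
      v₁≁v₄ : ¬ Adj G v₁ v₄
      v₁≁v₅ : ¬ Adj G v₁ v₅
      v₂≁v₄ : ¬ Adj G v₂ v₄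
      v₂≁v₅ : ¬ Adj G v₂ v₅
      v₃≁v₄ : ¬ Adj G v₃ v₄
      v₃≁v₅ : ¬ Adj G v₃ v₅
      v₄≁v₅ : ¬ Adj G v₄ v₅
      v₀≢v₂ : v₀ ≢ v₂
      v₁≢v₃ : v₁ ≢ v₃
      v₄≢v₅ : v₄ ≢ v₅

-- The only non-adjacent pairs of the co-bridge with equal neighbourhoods.
twin : Fin 6 → Fin 6
twin 0F = 2F
twin 1F = 3F
twin 2F = 0F
twin 3F = 1F
twin 4F = 5F
twin 5F = 4F

coBridge-separated : ∀ i j → i ≢ j →
                     T (coBridgeAdj i j) ⊎ (∃ λ k → coBridgeAdj i k ≢ coBridgeAdj j k) ⊎ j ≡ twin i
coBridge-separated = from-yes (Fin.all? λ i → Fin.all? λ j → ¬? (i Fin.≟ j) →-dec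
  (T? (coBridgeAdj i j) ⊎-dec Fin.any? (λ k → ¬? (coBridgeAdj i k Bool.≟ coBridgeAdj j k))
                        ⊎-dec j Fin.≟ twin i))

module _ {G : Graph N} where
  open Graph G

  induced⇒¬CoBridgeFree : InducedCoBridge G → ¬ CoBridgeFree G
  induced⇒¬CoBridgeFree c free = free (f , f-injective , f-adj)
    where
    open InducedCoBridge c

    f : Fin 6 → Fin N
    f 0F = v₀
    f 1F = v₁
    f 2F = v₂
    f 3F = v₃
    f 4F = v₄
    f 5F = v₅

    edge : Adj G u v → adj u v ≡ true
    edge = Equivalence.to Bool.T-≡

    edge′ : Adj G u v → adj v u ≡ true
    edge′ = edge ∘ Adj-sym G

    non-edge : ¬ Adj G u v → adj u v ≡ false
    non-edge ¬uv = Bool.¬-not (¬uv ∘ Equivalence.from Bool.T-≡)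

    non-edge′ : ¬ Adj G u v → adj v u ≡ false
    non-edge′ ¬uv = non-edge (¬uv ∘ Adj-sym G)

    f-adj : ∀ i j → adj (f i) (f j) ≡ coBridgeAdj i j
    f-adj 0F 0F = adj-irrefl v₀
    f-adj 0F 1F = edge v₀v₁
    f-adj 0F 2F = non-edge v₀≁v₂
    f-adj 0F 3F = edge′ v₃v₀
    f-adj 0F 4F = non-edge v₀≁v₄
    f-adj 0F 5F = non-edge v₀≁v₅
    f-adj 1F 0F = edge′ v₀v₁
    f-adj 1F 1F = adj-irrefl v₁
    f-adj 1F 2F = edge v₁v₂
    f-adj 1F 3F = non-edge v₁≁v₃
    f-adj 1F 4F = non-edge v₁≁v₄
    f-adj 1F 5F = non-edge v₁≁v₅
    f-adj 2F 0F = non-edge′ v₀≁v₂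
    f-adj 2F 1F = edge′ v₁v₂
    f-adj 2F 2F = adj-irrefl v₂
    f-adj 2F 3F = edge v₂v₃
    f-adj 2F 4F = non-edge v₂≁v₄
    f-adj 2F 5F = non-edge v₂≁v₅
    f-adj 3F 0F = edge v₃v₀
    f-adj 3F 1F = non-edge′ v₁≁v₃
    f-adj 3F 2F = edge′ v₂v₃
    f-adj 3F 3F = adj-irrefl v₃
    f-adj 3F 4F = non-edge v₃≁v₄
    f-adj 3F 5F = non-edge v₃≁v₅
    f-adj 4F 0F = non-edge′ v₀≁v₄
    f-adj 4F 1F = non-edge′ v₁≁v₄
    f-adj 4F 2F = non-edge′ v₂≁v₄
    f-adj 4F 3F = non-edge′ v₃≁v₄
    f-adj 4F 4F = adj-irrefl v₄
    f-adj 4F 5F = non-edge v₄≁v₅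
    f-adj 5F 0F = non-edge′ v₀≁v₅
    f-adj 5F 1F = non-edge′ v₁≁v₅
    f-adj 5F 2F = non-edge′ v₂≁v₅
    f-adj 5F 3F = non-edge′ v₃≁v₅
    f-adj 5F 4F = non-edge′ v₄≁v₅
    f-adj 5F 5F = adj-irrefl v₅

    twins-distinct : ∀ i → f i ≢ f (twin i)
    twins-distinct 0F = v₀≢v₂
    twins-distinct 1F = v₁≢v₃
    twins-distinct 2F = v₀≢v₂ ∘ sym
    twins-distinct 3F = v₁≢v₃ ∘ sym
    twins-distinct 4F = v₄≢v₅
    twins-distinct 5F = v₄≢v₅ ∘ sym

    f-injective : ∀ i j → f i ≡ f j → i ≡ j
    f-injective i j fi≡fj with i Fin.≟ j
    ... | yes i≡j = i≡j
    ... | no i≢j with coBridge-separated i j i≢j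
    ...   | inj₁ ij = ⊥-elim (Adj⇒≢ G (subst T (sym (f-adj i j)) ij) fi≡fj)
    ...   | inj₂ (inj₁ (k , differ)) =
            ⊥-elim (differ (trans (sym (f-adj i k)) (trans (cong (λ x → adj x (f k)) fi≡fj) (f-adj j k))))
    ...   | inj₂ (inj₂ refl) = ⊥-elim (twins-distinct i fi≡fj)

Meets : Fin N → Fin N → Fin N → VSet N → Set
Meets a b c S = a ∈ᵥ S ⊎ b ∈ᵥ S ⊎ c ∈ᵥ S

meets-mono : ∀ {a b c : Fin N} (S S′ : VSet N) → (∀ {v} → v ∈ᵥ S → v ∈ᵥ S′) → Meets a b c S → Meets a b c S′
meets-mono _ _ f = Sum.map f (Sum.map f f)

meets-witness : ∀ {a b c : Fin N} (S : VSet N) → Meets a b c S → ∃ (_∈ᵥ S)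
meets-witness _ = [ (_ ,_) , [ (_ ,_) , (_ ,_) ]′ ]′

meets-swap₁₂ : ∀ {a b c : Fin N} (S : VSet N) → Meets a b c S → Meets b a c S
meets-swap₁₂ _ (inj₁ a∈) = inj₂ (inj₁ a∈)
meets-swap₁₂ _ (inj₂ (inj₁ b∈)) = inj₁ b∈
meets-swap₁₂ _ (inj₂ (inj₂ c∈)) = inj₂ (inj₂ c∈)

meets-swap₂₃ : ∀ {a b c : Fin N} (S : VSet N) → Meets a b c S → Meets a c b S
meets-swap₂₃ _ (inj₁ a∈) = inj₁ a∈
meets-swap₂₃ _ (inj₂ (inj₁ b∈)) = inj₂ (inj₂ b∈)
meets-swap₂₃ _ (inj₂ (inj₂ c∈)) = inj₂ (inj₁ c∈)

triangle-free-hitting : (G : Graph N) → NoTriangle G → ∃ λ S → HittingSet G S × card S ≤ 5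
triangle-free-hitting {N} _ no-triangle =
  ∅ᵥ , (λ a b c t → ⊥-elim (no-triangle a b c t)) , subst (_≤ 5) (sym (card-∅ {N})) z≤n

-- The line graph of K₃,₃

Diagonal : LK33V → Set
Diagonal (a , b) = a ≡ b

LK33Adj? : ∀ x y → Dec (LK33Adj x y)
LK33Adj? (a , b) (c , d) = (a Fin.≟ c ⊎-dec b Fin.≟ d) ×-dec ¬? (a Fin.≟ c ×-dec b Fin.≟ d)

-- Three pairwise adjacent edges of K₃,₃ share an end k and have distinct other
-- ends, one of which is therefore k; checked exhaustively.
LK33-triangle-diagonal : ∀ x y z → LK33Adj x y → LK33Adj y z → LK33Adj x z →
                         Diagonal x ⊎ Diagonal y ⊎ Diagonal z
LK33-triangle-diagonal (a , b) (c , d) (e , f) = check a b c d e f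
  where
  check : ∀ a b c d e f → LK33Adj (a , b) (c , d) → LK33Adj (c , d) (e , f) → LK33Adj (a , b) (e , f) →
          a ≡ b ⊎ c ≡ d ⊎ e ≡ f
  check = from-yes (Fin.all? λ a → Fin.all? λ b → Fin.all? λ c → Fin.all? λ d → Fin.all? λ e → Fin.all? λ f →
    LK33Adj? (a , b) (c , d) →-dec LK33Adj? (c , d) (e , f) →-dec LK33Adj? (a , b) (e , f) →-dec
    (a Fin.≟ b ⊎-dec c Fin.≟ d ⊎-dec e Fin.≟ f))

LK33-hitting : (G : Graph N) → IsoLK33 G → ∃ λ S → HittingSet G S × card S ≤ 5
LK33-hitting G (φ , φ-adj) =
  S , hits , ≤-trans (card-⋃ᵥ≤length (allFin 3) F (λ k → card-⁅⁆ᵥ≤1 (from (k , k)))) (m≤m+n 3 2)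
  where
  open Inverse φ using (to; from; strictlyInverseʳ)

  F : Fin 3 → VSet _
  F k = ⁅ from (k , k) ⁆ᵥ

  S : VSet _
  S = ⋃ᵥ (allFin 3) F

  diagonal∈S : ∀ u → Diagonal (to u) → u ∈ᵥ S
  diagonal∈S u d = ∈-⋃ᵥ F (∈-allFin k) (fromWitness {a? = u Fin.≟ from (k , k)} u≡)
    where
    k = proj₁ (to u)
    u≡ : u ≡ from (k , k)
    u≡ = trans (sym (strictlyInverseʳ u)) (cong from (sym (cong (k ,_) d)))

  hits : HittingSet G S
  hits a b c (ab , bc , ac) =
    Sum.map (diagonal∈S a) (Sum.map (diagonal∈S b) (diagonal∈S c))
      (LK33-triangle-diagonal (to a) (to b) (to c)
        (Equivalence.to (φ-adj a b) ab) (Equivalence.to (φ-adj b c) bc) (Equivalence.to (φ-adj a c) ac))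

-- Arithmetic of part indices

-- By P2, vertices in parts at distance d can be adjacent only if Near d.
Near : ℕ → Set
Near d = d ≡ 1 ⊎ d % 3 ≡ 2

near? : ∀ d → Dec (Near d)
near? d = d ℕ.≟ 1 ⊎-dec d % 3 ℕ.≟ 2

private
  sum-residue : ∀ a b {r s} → a % 3 ≡ r → b % 3 ≡ s → (a + b) % 3 ≡ (r + s) % 3
  sum-residue a b refl refl = %-distribˡ-+ a b 3

near-sum : ∀ a b → 1 ≤ a → 1 ≤ b → Near a → Near b → Near (a + b) → a ≡ 1 × b ≡ 1
near-sum _ _ _ _ (inj₁ refl) (inj₁ refl) _ = refl , refl
near-sum a b 1≤a 1≤b _ _ (inj₁ a+b≡1) = ⊥-elim (<⇒≢ (+-mono-≤ 1≤a 1≤b) (sym a+b≡1))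
near-sum a b _ _ (inj₁ refl) (inj₂ b≡2) (inj₂ s) = case trans (sym s) (sum-residue 1 b refl b≡2) of λ ()
near-sum a b _ _ (inj₂ a≡2) (inj₁ refl) (inj₂ s) = case trans (sym s) (sum-residue a 1 a≡2 refl) of λ ()
near-sum a b _ _ (inj₂ a≡2) (inj₂ b≡2) (inj₂ s) = case trans (sym s) (sum-residue a b a≡2 b≡2) of λ ()

private
  m<m+k⇒1≤k : ∀ {m k} → m < m + k → 1 ≤ k
  m<m+k⇒1≤k {m} {k} m<m+k = subst (1 ≤_) (m+n∸m≡n m k) (m<n⇒0<n∸m m<m+k)

near-chain⇒consecutive : ∀ {p q r} → p < q → q < r → Near ∣ p - q ∣ → Near ∣ q - r ∣ → Near ∣ p - r ∣ →
             q ≡ suc p × r ≡ suc q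
near-chain⇒consecutive {p} p<q q<r pq qr pr with m≤n⇒∃[o]m+o≡n (<⇒≤ p<q) | m≤n⇒∃[o]m+o≡n (<⇒≤ q<r)
... | a , refl | b , refl with near-sum a b (m<m+k⇒1≤k p<q) (m<m+k⇒1≤k q<r)
                                 (subst Near (∣m-m+n∣≡n p a) pq)
                                 (subst Near (∣m-m+n∣≡n (p + a) b) qr)
                                 (subst Near (trans (cong (∣ p -_∣) (+-assoc p a b)) (∣m-m+n∣≡n p (a + b))) pr)
...   | refl , refl = +-comm p 1 , +-comm (p + 1) 1

even-or-odd : ∀ m → ∃ λ k → m ≡ 2 * k ⊎ m ≡ 2 * k + 1
even-or-odd zero = 0 , inj₁ refl
even-or-odd (suc m) with even-or-odd m
... | k , inj₁ refl = k , inj₂ (+-comm 1 (2 * k))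
... | k , inj₂ refl = suc k , inj₁ (trans (cong suc (+-comm (2 * k) 1)) (sym (*-suc 2 k)))

1≤2*m⇒1≤m : ∀ {m} → 1 ≤ 2 * m → 1 ≤ m
1≤2*m⇒1≤m {suc m} _ = s≤s z≤n

2*m≤2*n+1⇒m≤n : ∀ {m n} → 2 * m ≤ 2 * n + 1 → m ≤ n
2*m≤2*n+1⇒m≤n {m} {n} 2m≤2n+1 = ≮⇒≥ λ n<m →
  1+n≰n (≤-trans (≤-reflexive (trans (cong suc (+-comm (2 * n) 1)) (sym (*-suc 2 n))))
                 (≤-trans (*-monoʳ-≤ 2 n<m) 2m≤2n+1))

2*i+2≡2*[1+i] : ∀ i → 2 * i + 2 ≡ 2 * suc i
2*i+2≡2*[1+i] i = trans (+-comm (2 * i) 2) (sym (*-suc 2 i))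

2*[1+i]∸1≡2*i+1 : ∀ i → 2 * suc i ∸ 1 ≡ 2 * i + 1
2*[1+i]∸1≡2*i+1 i = trans (cong (_∸ 1) (*-suc 2 i)) (+-comm 1 (2 * i))

2*[1+i]∸2≡2*i : ∀ i → 2 * suc i ∸ 2 ≡ 2 * i
2*[1+i]∸2≡2*i i = cong (_∸ 2) (*-suc 2 i)

indices : ℕ → List ℕ
indices n = applyUpTo suc n

∈-indices : ∀ {i n} → 1 ≤ i → i ≤ n → i ∈ indices n
∈-indices {suc i} _ i<n = ∈-applyUpTo⁺ suc i<n

without : ℕ → List ℕ → List ℕ
without j = filter (λ i → ¬? (i ℕ.≟ j))

∈-without : ∀ {i j xs} → i ≢ j → i ∈ xs → i ∈ without j xs
∈-without {j = j} i≢j i∈xs = ∈-filter⁺ (λ i → ¬? (i ℕ.≟ j)) i∈xs i≢j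

length-without : ∀ {j xs} → j ∈ xs → length (without j xs) < length xs
length-without {j} {xs} j∈xs =
  filter-notAll (λ i → ¬? (i ℕ.≟ j)) xs (Any.map (λ j≡i i≢j → i≢j (sym j≡i)) j∈xs)

-- Paths of triangles

module GoodPartition {G : Graph N} {idx : Fin N → ℕ} {hat : Fin N → Bool} {side : Fin N → Side} {n : ℕ}
                     (gp : IsGoodPartition G idx hat side n) where
  open IsGoodPartition gp

  X Xh Xnh Ls Ms Rs : ℕ → VSet N
  X = Defs.X G idx hat side
  Xh = Defs.Xh G idx hat side
  Xnh = Defs.Xnh G idx hat side
  Ls = Defs.Ls G idx hat side
  Ms = Defs.Ms G idx hat side
  Rs = Defs.Rs G idx hat side

  SingletonHat : ℕ → Set
  SingletonHat i = card (Xh (2 * i)) ≡ 1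

  private
    variable
      k p q i : ℕ
      w′ : Fin N
      a b c x y z : Fin N

    T-∧ˡ : ∀ {s t} → T (s ∧ t) → T s
    T-∧ˡ = proj₁ ∘ Equivalence.to Bool.T-∧

    T-∧-intro : ∀ {s t} → T s → T t → T (s ∧ t)
    T-∧-intro s t = Equivalence.from Bool.T-∧ (s , t)

  ∈X⇒idx : v ∈ᵥ X k → idx v ≡ k
  ∈X⇒idx {v} {k} = ≡ᵇ⇒≡ (idx v) k

  idx⇒∈X : idx v ≡ k → v ∈ᵥ X k
  idx⇒∈X {v} {k} = ≡⇒≡ᵇ (idx v) k

  Xh⊆X : v ∈ᵥ Xh k → v ∈ᵥ X k
  Xh⊆X = T-∧ˡ

  Ls⊆X : v ∈ᵥ Ls k → v ∈ᵥ X k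
  Ls⊆X = T-∧ˡ

  Ms⊆X : v ∈ᵥ Ms k → v ∈ᵥ X k
  Ms⊆X = T-∧ˡ

  Rs⊆X : v ∈ᵥ Rs k → v ∈ᵥ X k
  Rs⊆X = T-∧ˡ

  Xnh⊆X : v ∈ᵥ Xnh k → v ∈ᵥ X k
  Xnh⊆X = T-∧ˡ

  X-hat-split : v ∈ᵥ X k → v ∈ᵥ Xh k ⊎ v ∈ᵥ Xnh k
  X-hat-split {v} v∈ with hat v
  ... | true = inj₁ (T-∧-intro v∈ tt)
  ... | false = inj₂ (T-∧-intro v∈ tt)

  X-side-split : v ∈ᵥ X k → v ∈ᵥ Ls k ⊎ v ∈ᵥ Ms k ⊎ v ∈ᵥ Rs k
  X-side-split {v} v∈ with side v
  ... | L = inj₁ (T-∧-intro v∈ tt)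
  ... | M = inj₂ (inj₁ (T-∧-intro v∈ tt))
  ... | R = inj₂ (inj₂ (T-∧-intro v∈ tt))

  X-disjoint : v ∈ᵥ X p → w ∈ᵥ X q → p ≢ q → v ≢ w
  X-disjoint v∈ w∈ p≢q refl = p≢q (trans (sym (∈X⇒idx v∈)) (∈X⇒idx w∈))

  ∈X-lower : v ∈ᵥ X k → 1 ≤ k
  ∈X-lower {v} v∈ = subst (1 ≤_) (∈X⇒idx v∈) (proj₁ (range v))

  ∈X-upper : v ∈ᵥ X k → k ≤ 2 * n + 1
  ∈X-upper {v} v∈ = subst (_≤ 2 * n + 1) (∈X⇒idx v∈) (proj₂ (range v))

  ∈X-even-bounds : ∀ i → v ∈ᵥ X (2 * i) → 1 ≤ i × i ≤ n
  ∈X-even-bounds _ v∈ = 1≤2*m⇒1≤m (∈X-lower v∈) , 2*m≤2*n+1⇒m≤n (∈X-upper v∈)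

  nonempty? : (P : VSet N) → Dec (∃ (_∈ᵥ P))
  nonempty? P = Fin.any? (λ v → T? (P v))

  hat-nonempty : ∀ i → 1 ≤ i → i ≤ n → ∃ (_∈ᵥ Xh (2 * i))
  hat-nonempty i 1≤i i≤n = card≥1⇒nonempty (P1-nonempty i 1≤i i≤n)

  matched-card : Matched G P Q → card P ≡ card Q
  matched-card = proj₁ ∘ proj₂

  same-part-nonadjacent : idx v ≡ idx w → ¬ Adj G v w
  same-part-nonadjacent {v} {w} v≡w = stable (idx v) v w (idx⇒∈X refl) (idx⇒∈X (sym v≡w))

  private
    ordered-adjacent⇒near : idx v < idx w → Adj G v w → Near (idx w ∸ idx v)
    ordered-adjacent⇒near {v} {w} v<w vw with (idx w ∸ idx v) % 3 ℕ.≟ 2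
    ... | yes ≡2 = inj₂ ≡2
    ... | no ≢2 with P2-2 (idx v) (idx w) (proj₁ (range v)) v<w (proj₂ (range w)) ≢2
    ...   | inj₁ w≡v+1 = inj₁ (trans (cong (_∸ idx v) w≡v+1) (m+n∸m≡n (idx v) 1))
    ...   | inj₂ anticomplete = ⊥-elim (anticomplete v w (idx⇒∈X refl) (idx⇒∈X refl) vw)

  adjacent⇒near : Adj G v w → Near ∣ idx v - idx w ∣
  adjacent⇒near {v} {w} vw with <-cmp (idx v) (idx w)
  ... | tri< v<w _ _ = subst Near (sym (m≤n⇒∣m-n∣≡n∸m (<⇒≤ v<w))) (ordered-adjacent⇒near v<w vw)
  ... | tri≈ _ v≡w _ = ⊥-elim (same-part-nonadjacent v≡w vw)
  ... | tri> _ _ w<v = subst Near (sym (m≤n⇒∣n-m∣≡n∸m (<⇒≤ w<v))) (ordered-adjacent⇒near w<v (Adj-sym G vw))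

  -- The side conditions of apart and joined are decided by evaluation at literal parts.
  apart : v ∈ᵥ X p → w ∈ᵥ X q → {False (near? ∣ p - q ∣)} → ¬ Adj G v w
  apart v∈ w∈ {far} vw =
    toWitnessFalse far (subst₂ (λ p q → Near ∣ p - q ∣) (∈X⇒idx v∈) (∈X⇒idx w∈) (adjacent⇒near vw))

  apart-∪ : v ∈ᵥ X k → w ∈ᵥ X p ∪ᵥ X q →
            {False (near? ∣ k - p ∣)} → {False (near? ∣ k - q ∣)} → ¬ Adj G v w
  apart-∪ {p = p} {q = q} v∈ w∈ {far₁} {far₂} =
    [ (λ w∈p → apart v∈ w∈p {far₁}) , (λ w∈q → apart v∈ w∈q {far₂}) ] (∪ᵥ-elim (X p) (X q) w∈)

  -- By P2 (1), parts at distance ≡ 2 (mod 3) are complete, except two odd parts at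
  -- distance 2 and the non-hat vertices of two even parts.
  Joinable : ℕ → ℕ → Set
  Joinable p q = p < q × (q ∸ p) % 3 ≡ 2 × q ≢ p + 2 × ¬ (p % 2 ≡ 0 × q % 2 ≡ 0)

  joinable? : ∀ p q → Dec (Joinable p q)
  joinable? p q =
    p ℕ.<? q ×-dec (q ∸ p) % 3 ℕ.≟ 2 ×-dec ¬? (q ℕ.≟ p + 2) ×-dec ¬? (p % 2 ℕ.≟ 0 ×-dec q % 2 ℕ.≟ 0)

  joined : v ∈ᵥ X p → w ∈ᵥ X q → {True (joinable? p q)} → Adj G v w
  joined {v} {p} {w} {q} v∈ w∈ {j} with toWitness j
  ... | p<q , ≡2 , q≢p+2 , ¬even = decidable-stable (T? _) λ ¬vw →
    [ (λ (_ , _ , q≡p+2) → q≢p+2 q≡p+2) , (λ (p-even , q-even , _) → ¬even (p-even , q-even)) ]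
      (P2-1 p q (∈X-lower v∈) p<q (∈X-upper w∈) ≡2 v w v∈ w∈ ¬vw)

  consecutive-hats-adjacent : ∀ i → v ∈ᵥ Xh (2 * i) → w ∈ᵥ Xh (2 * i + 2) → Adj G v w
  consecutive-hats-adjacent {v} {w} i v∈ w∈ = decidable-stable (T? _) λ ¬vw →
    [ (λ (2i-odd , _) → case trans (sym 2i-even) 2i-odd of λ ()) , (λ (_ , _ , v∉ , _) → v∉ v∈) ]
      (P2-1 (2 * i) (2 * i + 2) (∈X-lower (Xh⊆X v∈)) (m<m+n (2 * i) (s≤s z≤n)) (∈X-upper (Xh⊆X w∈))
            (cong (_% 3) (m+n∸m≡n (2 * i) 2)) v w (Xh⊆X v∈) (Xh⊆X w∈) ¬vw)
    where
    2i-even : (2 * i) % 2 ≡ 0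
    2i-even = trans (cong (_% 2) (*-comm 2 i)) (m*n%n≡0 i 2)

  private
    hat-complete : ∀ i → SingletonHat i → v ∈ᵥ Xh (2 * i) →
                   w ∈ᵥ Rs (2 * i ∸ 1) ∪ᵥ Ms (2 * i ∸ 1) ∪ᵥ Ls (2 * i + 1) ∪ᵥ Ms (2 * i + 1) → Adj G v w
    hat-complete {v} {w} i single v∈ = uncurry (P5-2 i) (∈X-even-bounds i (Xh⊆X v∈)) single v w v∈

  singleton-hat-adj-Rs : ∀ i → SingletonHat i → v ∈ᵥ Xh (2 * i) → w ∈ᵥ Rs (2 * i ∸ 1) → Adj G v w
  singleton-hat-adj-Rs i single v∈ w∈ = hat-complete i single v∈
    (∪ᵥ-introˡ (Rs (2 * i ∸ 1)) (Ms (2 * i ∸ 1) ∪ᵥ Ls (2 * i + 1) ∪ᵥ Ms (2 * i + 1)) w∈)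

  singleton-hat-adj-Ms⁻ : ∀ i → SingletonHat i → v ∈ᵥ Xh (2 * i) → w ∈ᵥ Ms (2 * i ∸ 1) → Adj G v w
  singleton-hat-adj-Ms⁻ i single v∈ w∈ = hat-complete i single v∈
    (∪ᵥ-introʳ (Rs (2 * i ∸ 1)) (Ms (2 * i ∸ 1) ∪ᵥ Ls (2 * i + 1) ∪ᵥ Ms (2 * i + 1))
      (∪ᵥ-introˡ (Ms (2 * i ∸ 1)) (Ls (2 * i + 1) ∪ᵥ Ms (2 * i + 1)) w∈))

  singleton-hat-adj-Ms⁺ : ∀ i → SingletonHat i → v ∈ᵥ Xh (2 * i) → w ∈ᵥ Ms (2 * i + 1) → Adj G v w
  singleton-hat-adj-Ms⁺ i single v∈ w∈ = hat-complete i single v∈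
    (∪ᵥ-introʳ (Rs (2 * i ∸ 1)) (Ms (2 * i ∸ 1) ∪ᵥ Ls (2 * i + 1) ∪ᵥ Ms (2 * i + 1))
      (∪ᵥ-introʳ (Ms (2 * i ∸ 1)) (Ls (2 * i + 1) ∪ᵥ Ms (2 * i + 1))
        (∪ᵥ-introʳ (Ls (2 * i + 1)) (Ms (2 * i + 1)) w∈)))

  X≁Ls⁻ : ∀ i → v ∈ᵥ X (2 * i) → w ∈ᵥ Ls (2 * i ∸ 1) → ¬ Adj G v w
  X≁Ls⁻ {v} {w} i v∈ w∈ =
    uncurry (P4-1 i) (∈X-even-bounds i v∈) v w v∈ (∪ᵥ-introˡ (Ls (2 * i ∸ 1)) (Rs (2 * i + 1)) w∈)

  X≁Rs⁺ : ∀ i → v ∈ᵥ X (2 * i) → w ∈ᵥ Rs (2 * i + 1) → ¬ Adj G v w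
  X≁Rs⁺ {v} {w} i v∈ w∈ =
    uncurry (P4-1 i) (∈X-even-bounds i v∈) v w v∈ (∪ᵥ-introʳ (Ls (2 * i ∸ 1)) (Rs (2 * i + 1)) w∈)

  Xnh≁Ms⁻ : ∀ i → v ∈ᵥ Xnh (2 * i) → w ∈ᵥ Ms (2 * i ∸ 1) → ¬ Adj G v w
  Xnh≁Ms⁻ {v} {w} i v∈ w∈ =
    uncurry (P4-2 i) (∈X-even-bounds i (Xnh⊆X v∈)) v w v∈ (∪ᵥ-introˡ (Ms (2 * i ∸ 1)) (Ms (2 * i + 1)) w∈)

  Xnh≁Ms⁺ : ∀ i → v ∈ᵥ Xnh (2 * i) → w ∈ᵥ Ms (2 * i + 1) → ¬ Adj G v w
  Xnh≁Ms⁺ {v} {w} i v∈ w∈ =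
    uncurry (P4-2 i) (∈X-even-bounds i (Xnh⊆X v∈)) v w v∈ (∪ᵥ-introʳ (Ms (2 * i ∸ 1)) (Ms (2 * i + 1)) w∈)

  neighbours : ℕ → VSet N
  neighbours i = Rs (2 * i ∸ 1) ∪ᵥ Xh (2 * i ∸ 2) ∪ᵥ Xh (2 * i + 2)

  -- meets-neighbour is what allows dropping X̂₄ from the hitting set when n = 6.
  record MeetsSingletonHat (a b c : Fin N) : Set where
    constructor singleton-hat-at
    field
      index : ℕ
      singleton : SingletonHat index
      meets-hat : Meets a b c (Xh (2 * index))
      meets-neighbour : Meets a b c (neighbours index)

  triangle-around-X₂ᵢ : ∀ i → x ∈ᵥ X (2 * i ∸ 1) → y ∈ᵥ X (2 * i) → z ∈ᵥ X (2 * i + 1) → Triangle G x y z →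
                 MeetsSingletonHat x y z
  triangle-around-X₂ᵢ {x} {y} {z} i x∈ y∈ z∈ (xy , yz , xz) =
    singleton-hat-at i single (inj₂ (inj₁ y∈ʰ))
      (inj₁ (∪ᵥ-introˡ (Rs (2 * i ∸ 1)) (Xh (2 * i ∸ 2) ∪ᵥ Xh (2 * i + 2)) x∈R))
    where
    1≤i = proj₁ (∈X-even-bounds i y∈)
    i≤n = proj₂ (∈X-even-bounds i y∈)

    x∉L : ¬ x ∈ᵥ Ls (2 * i ∸ 1)
    x∉L x∈L = X≁Ls⁻ i y∈ x∈L (Adj-sym G xy)

    z∉R : ¬ z ∈ᵥ Rs (2 * i + 1)
    z∉R z∈R = X≁Rs⁺ i y∈ z∈R yz

    y∈ʰ : y ∈ᵥ Xh (2 * i)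
    y∈ʰ with X-hat-split y∈
    ... | inj₁ y∈ʰ = y∈ʰ
    ... | inj₂ y∈ⁿ with X-side-split x∈ | X-side-split z∈
    ...   | inj₁ x∈L | _ = ⊥-elim (x∉L x∈L)
    ...   | inj₂ (inj₁ x∈M) | _ = ⊥-elim (Xnh≁Ms⁻ i y∈ⁿ x∈M (Adj-sym G xy))
    ...   | inj₂ (inj₂ _) | inj₂ (inj₁ z∈M) = ⊥-elim (Xnh≁Ms⁺ i y∈ⁿ z∈M yz)
    ...   | inj₂ (inj₂ _) | inj₂ (inj₂ z∈R) = ⊥-elim (z∉R z∈R)
    ...   | inj₂ (inj₂ x∈R) | inj₁ z∈L = ⊥-elim
            ([ (λ (_ , ¬yz) → ¬yz yz) , (λ (¬yx , _) → ¬yx (Adj-sym G xy)) ]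
               (P4-3 i 1≤i i≤n y x z y∈ⁿ x∈R z∈L xz))

    single : SingletonHat i
    single = decidable-stable (card (Xh (2 * i)) ℕ.≟ 1) λ ¬single →
      Equivalence.from (P6-2 i 1≤i i≤n (≤∧≢⇒< (P1-nonempty i 1≤i i≤n) (¬single ∘ sym)) x z x∈ z∈)
        (y , y∈ʰ , Adj-sym G xy , yz) xz

    x∈R : x ∈ᵥ Rs (2 * i ∸ 1)
    x∈R with X-side-split x∈ | X-side-split z∈
    ... | inj₁ x∈L | _ = ⊥-elim (x∉L x∈L)
    ... | inj₂ (inj₂ x∈R) | _ = x∈R
    ... | inj₂ (inj₁ _) | inj₂ (inj₂ z∈R) = ⊥-elim (z∉R z∈R)
    ... | inj₂ (inj₁ x∈M) | inj₁ z∈L = proj₁ (P5-1b i 1≤i i≤n single x z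
            (∪ᵥ-introˡ (Ms (2 * i ∸ 1)) (Rs (2 * i ∸ 1)) x∈M)
            (∪ᵥ-introˡ (Ls (2 * i + 1)) (Ms (2 * i + 1)) z∈L) xz)
    ... | inj₂ (inj₁ x∈M) | inj₂ (inj₁ z∈M) = proj₁ (P5-1b i 1≤i i≤n single x z
            (∪ᵥ-introˡ (Ms (2 * i ∸ 1)) (Rs (2 * i ∸ 1)) x∈M)
            (∪ᵥ-introʳ (Ls (2 * i + 1)) (Ms (2 * i + 1)) z∈M) xz)

  triangle-around-X₂ᵢ₊₁ : ∀ i → x ∈ᵥ X (2 * i) → y ∈ᵥ X (2 * i + 1) → z ∈ᵥ X (2 * i + 2) → Triangle G x y z →
                  MeetsSingletonHat x y z
  triangle-around-X₂ᵢ₊₁ {x} {y} {z} i x∈ y∈ z∈ (xy , yz , xz) =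
    [ lower-singleton , upper-singleton ]′ (P1-one i (proj₁ (∈X-even-bounds i x∈)) i<n)
    where
    z∈′ : z ∈ᵥ X (2 * suc i)
    z∈′ = subst (λ k → z ∈ᵥ X k) (2*i+2≡2*[1+i] i) z∈

    i<n : i < n
    i<n = proj₂ (∈X-even-bounds (suc i) z∈′)

    y∈M : y ∈ᵥ Ms (2 * i + 1)
    y∈M with X-side-split y∈
    ... | inj₁ y∈L =
          ⊥-elim (X≁Ls⁻ (suc i) z∈′ (subst (λ k → y ∈ᵥ Ls k) (sym (2*[1+i]∸1≡2*i+1 i)) y∈L) (Adj-sym G yz))
    ... | inj₂ (inj₁ y∈M) = y∈M
    ... | inj₂ (inj₂ y∈R) = ⊥-elim (X≁Rs⁺ i x∈ y∈R xy)

    x∈ʰ : x ∈ᵥ Xh (2 * i)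
    x∈ʰ = [ id , (λ x∈ⁿ → ⊥-elim (Xnh≁Ms⁺ i x∈ⁿ y∈M xy)) ] (X-hat-split x∈)

    z∈ʰ : z ∈ᵥ Xh (2 * suc i)
    z∈ʰ = [ id , (λ z∈ⁿ → ⊥-elim (Xnh≁Ms⁻ (suc i) z∈ⁿ y∈M′ (Adj-sym G yz))) ] (X-hat-split z∈′)
      where
      y∈M′ : y ∈ᵥ Ms (2 * suc i ∸ 1)
      y∈M′ = subst (λ k → y ∈ᵥ Ms k) (sym (2*[1+i]∸1≡2*i+1 i)) y∈M

    lower-singleton : SingletonHat i → MeetsSingletonHat x y z
    lower-singleton single = singleton-hat-at i single (inj₁ x∈ʰ)
      (inj₂ (inj₂ (∪ᵥ-introʳ (Rs (2 * i ∸ 1)) (Xh (2 * i ∸ 2) ∪ᵥ Xh (2 * i + 2))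
                    (∪ᵥ-introʳ (Xh (2 * i ∸ 2)) (Xh (2 * i + 2))
                      (subst (λ k → z ∈ᵥ Xh k) (sym (2*i+2≡2*[1+i] i)) z∈ʰ)))))

    upper-singleton : card (Xh (2 * i + 2)) ≡ 1 → MeetsSingletonHat x y z
    upper-singleton single = singleton-hat-at (suc i) (subst (λ k → card (Xh k) ≡ 1) (2*i+2≡2*[1+i] i) single)
      (inj₂ (inj₂ z∈ʰ))
      (inj₁ (∪ᵥ-introʳ (Rs (2 * suc i ∸ 1)) (Xh (2 * suc i ∸ 2) ∪ᵥ Xh (2 * suc i + 2))
              (∪ᵥ-introˡ (Xh (2 * suc i ∸ 2)) (Xh (2 * suc i + 2))
                (subst (λ k → x ∈ᵥ Xh k) (sym (2*[1+i]∸2≡2*i i)) x∈ʰ))))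

  sorted-triangle-meets-singleton-hat : idx x < idx y → idx y < idx z → Triangle G x y z →
                                        MeetsSingletonHat x y z
  sorted-triangle-meets-singleton-hat {x} {y} {z} x<y y<z t@(xy , yz , xz) =
    by-parity (near-chain⇒consecutive x<y y<z (adjacent⇒near xy) (adjacent⇒near yz) (adjacent⇒near xz))
              (even-or-odd (idx y))
    where
    by-parity : idx y ≡ suc (idx x) × idx z ≡ suc (idx y) → (∃ λ i → idx y ≡ 2 * i ⊎ idx y ≡ 2 * i + 1) →
                MeetsSingletonHat x y z
    by-parity (y≡1+x , z≡1+y) (i , inj₁ y≡2i) =
      triangle-around-X₂ᵢ i (idx⇒∈X (trans (sym (cong (_∸ 1) y≡1+x)) (cong (_∸ 1) y≡2i)))
                     (idx⇒∈X y≡2i)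
                     (idx⇒∈X (trans z≡1+y (trans (cong suc y≡2i) (+-comm 1 (2 * i))))) t
    by-parity (y≡1+x , z≡1+y) (i , inj₂ y≡2i+1) =
      triangle-around-X₂ᵢ₊₁ i (idx⇒∈X (suc-injective (trans (sym y≡1+x) (trans y≡2i+1 (+-comm (2 * i) 1)))))
                      (idx⇒∈X y≡2i+1)
                      (idx⇒∈X (trans z≡1+y (trans (cong suc y≡2i+1) (sym (+-suc (2 * i) 1))))) t

  sort-triangle : (P : Fin N → Fin N → Fin N → Set) →
                  (∀ {a b c} → P a b c → P b a c) → (∀ {a b c} → P a b c → P a c b) →
                  (∀ {x y z} → idx x < idx y → idx y < idx z → Triangle G x y z → P x y z) →
                  Triangle G a b c → P a b c
  sort-triangle {a} {b} {c} P swap₁₂ swap₂₃ sorted t@(ab , bc , ac)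
    with <-cmp (idx a) (idx b) | <-cmp (idx b) (idx c) | <-cmp (idx a) (idx c)
  ... | tri≈ _ a≡b _ | _ | _ = ⊥-elim (same-part-nonadjacent a≡b ab)
  ... | _ | tri≈ _ b≡c _ | _ = ⊥-elim (same-part-nonadjacent b≡c bc)
  ... | _ | _ | tri≈ _ a≡c _ = ⊥-elim (same-part-nonadjacent a≡c ac)
  ... | tri< a<b _ _ | tri< b<c _ _ | _ = sorted a<b b<c t
  ... | tri< _ _ _ | tri> _ _ c<b | tri< a<c _ _ = swap₂₃ (sorted a<c c<b (triangle-swap₂₃ G t))
  ... | tri< a<b _ _ | tri> _ _ _ | tri> _ _ c<a =
        swap₂₃ (swap₁₂ (sorted c<a a<b (triangle-swap₁₂ G (triangle-swap₂₃ G t))))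
  ... | tri> _ _ b<a | tri< _ _ _ | tri< a<c _ _ = swap₁₂ (sorted b<a a<c (triangle-swap₁₂ G t))
  ... | tri> _ _ _ | tri< b<c _ _ | tri> _ _ c<a =
        swap₁₂ (swap₂₃ (sorted b<c c<a (triangle-swap₂₃ G (triangle-swap₁₂ G t))))
  ... | tri> _ _ b<a | tri> _ _ c<b | _ =
        swap₁₂ (swap₂₃ (swap₁₂ (sorted c<b b<a (triangle-swap₁₂ G (triangle-swap₂₃ G (triangle-swap₁₂ G t))))))

  triangle-meets-singleton-hat : Triangle G a b c → MeetsSingletonHat a b c
  triangle-meets-singleton-hat =
    sort-triangle MeetsSingletonHat swap₁₂ swap₂₃ sorted-triangle-meets-singleton-hat
    where
    swap₁₂ : ∀ {a b c} → MeetsSingletonHat a b c → MeetsSingletonHat b a c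
    swap₁₂ (singleton-hat-at i single onHat onNbr) =
      singleton-hat-at i single (meets-swap₁₂ (Xh (2 * i)) onHat) (meets-swap₁₂ (neighbours i) onNbr)
    swap₂₃ : ∀ {a b c} → MeetsSingletonHat a b c → MeetsSingletonHat a c b
    swap₂₃ (singleton-hat-at i single onHat onNbr) =
      singleton-hat-at i single (meets-swap₂₃ (Xh (2 * i)) onHat) (meets-swap₂₃ (neighbours i) onNbr)

  open MeetsSingletonHat

  index-bounds : (m : MeetsSingletonHat a b c) → 1 ≤ index m × index m ≤ n
  index-bounds m = ∈X-even-bounds (index m) (Xh⊆X (proj₂ (meets-witness (Xh (2 * index m)) (meets-hat m))))

  hatIfSingleton : ℕ → VSet N
  hatIfSingleton i v = Xh (2 * i) v ∧ (card (Xh (2 * i)) ℕ.≡ᵇ 1)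

  card-hatIfSingleton : ∀ i → card (hatIfSingleton i) ≤ 1
  card-hatIfSingleton i with card (Xh (2 * i)) ℕ.≡ᵇ 1 in single
  ... | true = ≤-reflexive (trans (card-cong (λ v → Bool.∧-identityʳ (Xh (2 * i) v)))
                                  (≡ᵇ⇒≡ _ 1 (Equivalence.from Bool.T-≡ single)))
  ... | false = subst (_≤ 1) (sym (trans (card-cong (λ v → Bool.∧-zeroʳ (Xh (2 * i) v))) (card-∅ {N}))) z≤n

  singleton-hat⊆hatIfSingleton : ∀ i → SingletonHat i → v ∈ᵥ Xh (2 * i) → v ∈ᵥ hatIfSingleton i
  singleton-hat⊆hatIfSingleton _ single v∈ = T-∧-intro v∈ (≡⇒≡ᵇ _ 1 single)

  hats : List ℕ → VSet N
  hats I = ⋃ᵥ I hatIfSingleton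

  card-hats : ∀ I → card (hats I) ≤ length I
  card-hats I = card-⋃ᵥ≤length I hatIfSingleton card-hatIfSingleton

  meets-hats : ∀ {I} → i ∈ I → SingletonHat i → Meets a b c (Xh (2 * i)) → Meets a b c (hats I)
  meets-hats {i} {I = I} i∈I single =
    meets-mono (Xh (2 * i)) (hats I) (λ v∈ → ∈-⋃ᵥ hatIfSingleton i∈I (singleton-hat⊆hatIfSingleton i single v∈))

  short-path-hitting : n ≤ 5 → ∃ λ S → HittingSet G S × card S ≤ 5
  short-path-hitting n≤5 =
    hats (indices n) , hits , ≤-trans (card-hats (indices n)) (subst (_≤ 5) (sym (length-applyUpTo suc n)) n≤5)
    where
    hits : HittingSet G (hats (indices n))
    hits a b c t = meets-hats (uncurry ∈-indices (index-bounds m)) (singleton m) (meets-hat m)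
      where m = triangle-meets-singleton-hat t

  hats-without-hitting : ∀ j → (∀ {a b c} (m : MeetsSingletonHat a b c) → index m ≡ j →
                                  Meets a b c (hats (without j (indices n)))) →
                         HittingSet G (hats (without j (indices n)))
  hats-without-hitting j at-j a b c t with triangle-meets-singleton-hat t
  ... | m with index m ℕ.≟ j
  ...   | yes i≡j = at-j m i≡j
  ...   | no i≢j = meets-hats (∈-without i≢j (uncurry ∈-indices (index-bounds m))) (singleton m) (meets-hat m)

  -- In each configuration the cycle edges come from P2 (1) and P5 and the non-edges from P2 (2).
  co-bridge-via-R₁ : v ∈ᵥ Rs 1 → w ∈ᵥ Xh 2 → x ∈ᵥ Xh 4 → y ∈ᵥ X 8 → z ∈ᵥ X 11 → a ∈ᵥ X 15 →
                     InducedCoBridge G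
  co-bridge-via-R₁ {v} {w} {x} {y} {z} {a} v∈ w∈ x∈ y∈ z∈ a∈ = record
    { v₀ = v ; v₁ = w ; v₂ = x ; v₃ = a ; v₄ = y ; v₅ = z
    ; v₀v₁ = Adj-sym G (singleton-hat-adj-Rs 1 (proj₁ P7-1) w∈ v∈)
    ; v₁v₂ = consecutive-hats-adjacent 1 w∈ x∈
    ; v₂v₃ = joined x∈X a∈
    ; v₃v₀ = Adj-sym G (joined v∈X a∈)
    ; v₀≁v₂ = apart v∈X x∈X
    ; v₁≁v₃ = apart w∈X a∈
    ; v₀≁v₄ = apart v∈X y∈
    ; v₀≁v₅ = apart v∈X z∈
    ; v₁≁v₄ = apart w∈X y∈
    ; v₁≁v₅ = apart w∈X z∈
    ; v₂≁v₄ = apart x∈X y∈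
    ; v₂≁v₅ = apart x∈X z∈
    ; v₃≁v₄ = apart a∈ y∈
    ; v₃≁v₅ = apart a∈ z∈
    ; v₄≁v₅ = apart y∈ z∈
    ; v₀≢v₂ = X-disjoint v∈X x∈X λ ()
    ; v₁≢v₃ = X-disjoint w∈X a∈ λ ()
    ; v₄≢v₅ = X-disjoint y∈ z∈ λ ()
    }
    where
    v∈X = Rs⊆X v∈
    w∈X = Xh⊆X w∈
    x∈X = Xh⊆X x∈

  co-bridge-via-M₃ : v ∈ᵥ Xh 2 → w ∈ᵥ Ms 3 → w′ ∈ᵥ Ms 3 → w ≢ w′ → x ∈ᵥ X 8 →
                     y ∈ᵥ X 12 ∪ᵥ X 15 → z ∈ᵥ X 12 ∪ᵥ X 15 → y ≢ z → InducedCoBridge G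
  co-bridge-via-M₃ {v} {w} {w′} {x} {y} {z} v∈ w∈ w′∈ w≢w′ x∈ y∈ z∈ y≢z = record
    { v₀ = v ; v₁ = w ; v₂ = x ; v₃ = w′ ; v₄ = y ; v₅ = z
    ; v₀v₁ = singleton-hat-adj-Ms⁺ 1 (proj₁ P7-1) v∈ w∈
    ; v₁v₂ = joined w∈X x∈
    ; v₂v₃ = Adj-sym G (joined w′∈X x∈)
    ; v₃v₀ = Adj-sym G (singleton-hat-adj-Ms⁺ 1 (proj₁ P7-1) v∈ w′∈)
    ; v₀≁v₂ = apart v∈X x∈
    ; v₁≁v₃ = apart w∈X w′∈X
    ; v₀≁v₄ = apart-∪ v∈X y∈
    ; v₀≁v₅ = apart-∪ v∈X z∈
    ; v₁≁v₄ = apart-∪ w∈X y∈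
    ; v₁≁v₅ = apart-∪ w∈X z∈
    ; v₂≁v₄ = apart-∪ x∈ y∈
    ; v₂≁v₅ = apart-∪ x∈ z∈
    ; v₃≁v₄ = apart-∪ w′∈X y∈
    ; v₃≁v₅ = apart-∪ w′∈X z∈
    ; v₄≁v₅ = [ (λ y∈′ → apart-∪ y∈′ z∈) , (λ y∈′ → apart-∪ y∈′ z∈) ]′ (∪ᵥ-elim (X 12) (X 15) y∈)
    ; v₀≢v₂ = X-disjoint v∈X x∈ λ ()
    ; v₁≢v₃ = w≢w′
    ; v₄≢v₅ = y≢z
    }
    where
    v∈X = Xh⊆X v∈
    w∈X = Ms⊆X w∈
    w′∈X = Ms⊆X w′∈

  co-bridge-via-M₁₃ : SingletonHat 7 → v ∈ᵥ Xh 14 → w ∈ᵥ Ms 13 → w′ ∈ᵥ Ms 13 → w ≢ w′ → x ∈ᵥ X 8 →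
                      y ∈ᵥ X 1 ∪ᵥ X 4 → z ∈ᵥ X 1 ∪ᵥ X 4 → y ≢ z → InducedCoBridge G
  co-bridge-via-M₁₃ {v} {w} {w′} {x} {y} {z} single v∈ w∈ w′∈ w≢w′ x∈ y∈ z∈ y≢z = record
    { v₀ = v ; v₁ = w ; v₂ = x ; v₃ = w′ ; v₄ = y ; v₅ = z
    ; v₀v₁ = singleton-hat-adj-Ms⁻ 7 single v∈ w∈
    ; v₁v₂ = Adj-sym G (joined x∈ w∈X)
    ; v₂v₃ = joined x∈ w′∈X
    ; v₃v₀ = Adj-sym G (singleton-hat-adj-Ms⁻ 7 single v∈ w′∈)
    ; v₀≁v₂ = apart v∈X x∈
    ; v₁≁v₃ = apart w∈X w′∈X
    ; v₀≁v₄ = apart-∪ v∈X y∈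
    ; v₀≁v₅ = apart-∪ v∈X z∈
    ; v₁≁v₄ = apart-∪ w∈X y∈
    ; v₁≁v₅ = apart-∪ w∈X z∈
    ; v₂≁v₄ = apart-∪ x∈ y∈
    ; v₂≁v₅ = apart-∪ x∈ z∈
    ; v₃≁v₄ = apart-∪ w′∈X y∈
    ; v₃≁v₅ = apart-∪ w′∈X z∈
    ; v₄≁v₅ = [ (λ y∈′ → apart-∪ y∈′ z∈) , (λ y∈′ → apart-∪ y∈′ z∈) ]′ (∪ᵥ-elim (X 1) (X 4) y∈)
    ; v₀≢v₂ = X-disjoint v∈X x∈ λ ()
    ; v₁≢v₃ = w≢w′
    ; v₄≢v₅ = y≢z
    }
    where
    v∈X = Xh⊆X v∈
    w∈X = Ms⊆X w∈
    w′∈X = Ms⊆X w′∈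

  co-bridge-via-R₃ : SingletonHat 2 → v ∈ᵥ Rs 1 → w ∈ᵥ Rs 3 → x ∈ᵥ Xh 4 → y ∈ᵥ Xh 6 → z ∈ᵥ X 10 → a ∈ᵥ X 13 →
                     InducedCoBridge G
  co-bridge-via-R₃ {v} {w} {x} {y} {z} {a} single v∈ w∈ x∈ y∈ z∈ a∈ = record
    { v₀ = v ; v₁ = w ; v₂ = x ; v₃ = y ; v₄ = z ; v₅ = a
    ; v₀v₁ = P5-3b 1 ≤-refl n≥1 (proj₁ P7-1) v w v∈X w∈
    ; v₁v₂ = Adj-sym G (singleton-hat-adj-Rs 2 single x∈ w∈)
    ; v₂v₃ = consecutive-hats-adjacent 2 x∈ y∈
    ; v₃v₀ = Adj-sym G (joined v∈X y∈X)
    ; v₀≁v₂ = apart v∈X x∈X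
    ; v₁≁v₃ = apart w∈X y∈X
    ; v₀≁v₄ = apart v∈X z∈
    ; v₀≁v₅ = apart v∈X a∈
    ; v₁≁v₄ = apart w∈X z∈
    ; v₁≁v₅ = apart w∈X a∈
    ; v₂≁v₄ = apart x∈X z∈
    ; v₂≁v₅ = apart x∈X a∈
    ; v₃≁v₄ = apart y∈X z∈
    ; v₃≁v₅ = apart y∈X a∈
    ; v₄≁v₅ = apart z∈ a∈
    ; v₀≢v₂ = X-disjoint v∈X x∈X λ ()
    ; v₁≢v₃ = X-disjoint w∈X y∈X λ ()
    ; v₄≢v₅ = X-disjoint z∈ a∈ λ ()
    }
    where
    v∈X = Rs⊆X v∈
    w∈X = Rs⊆X w∈
    x∈X = Xh⊆X x∈
    y∈X = Xh⊆X y∈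

  ¬nonempty⇒Empty : ¬ ∃ (_∈ᵥ P) → Empty P
  ¬nonempty⇒Empty ¬∃ v v∈ = ¬∃ (v , v∈)

  M₂ᵢ₊₁-matched : ∀ i → 1 ≤ i → i < n →
                   Matched G (Ms (2 * i + 1)) (Xh (2 * i)) ⊎ Matched G (Ms (2 * i + 1)) (Xh (2 * i + 2))
  M₂ᵢ₊₁-matched i 1≤i i<n with P1-one i 1≤i i<n
  ... | inj₁ single = inj₂ (P5-4b i 1≤i (<⇒≤ i<n) single i<n)
  ... | inj₂ single′ = inj₁ (subst₂ (λ k l → Matched G (Ms k) (Xh l)) (2*[1+i]∸1≡2*i+1 i) (2*[1+i]∸2≡2*i i)
          (P5-4a (suc i) (s≤s z≤n) i<n (subst (λ k → card (Xh k) ≡ 1) (2*i+2≡2*[1+i] i) single′) (s≤s 1≤i)))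

  X₂ᵢ₊₁-nonempty : ∀ i → 1 ≤ i → i < n → ∃ (_∈ᵥ X (2 * i + 1))
  X₂ᵢ₊₁-nonempty i 1≤i i<n = Product.map₂ Ms⊆X (card≥1⇒nonempty
    ([ via (P1-nonempty i 1≤i (<⇒≤ i<n))
     , via (subst (λ k → 1 ≤ card (Xh k)) (sym (2*i+2≡2*[1+i] i)) (P1-nonempty (suc i) (s≤s z≤n) i<n)) ]′
       (M₂ᵢ₊₁-matched i 1≤i i<n)))
    where
    via : ∀ {H} → 1 ≤ card H → Matched G (Ms (2 * i + 1)) H → 1 ≤ card (Ms (2 * i + 1))
    via 1≤∣H∣ matched = subst (1 ≤_) (sym (matched-card matched)) 1≤∣H∣

  R₁-empty⇒∣M₃∣>1 : Empty (Rs 1) → 1 < card (Ms 3)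
  R₁-empty⇒∣M₃∣>1 ¬R₁ =
    subst (1 <_) (sym (matched-card (P5-4b 1 ≤-refl n≥1 (proj₁ P7-1) (proj₁ (P7-3a ¬R₁))))) (proj₂ (P7-3a ¬R₁))

  L₂ₙ₊₁-empty⇒∣M₂ₙ₋₁∣>1 : Empty (Ls (2 * n + 1)) → 1 < card (Ms (2 * n ∸ 1))
  L₂ₙ₊₁-empty⇒∣M₂ₙ₋₁∣>1 ¬L =
    subst (1 <_) (sym (matched-card (P5-4a n n≥1 ≤-refl (proj₂ P7-1) (proj₁ (P7-3b ¬L))))) (proj₂ (P7-3b ¬L))

  co-bridge-if-X₁₅-nonempty : 7 ≤ n → z ∈ᵥ X 15 → InducedCoBridge G
  co-bridge-if-X₁₅-nonempty 7≤n z∈ = case nonempty? (Rs 1) of λ where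
      (yes (r , r∈)) →
        co-bridge-via-R₁ r∈ h₂∈ h₄∈ (Xh⊆X h₈∈) (proj₂ (X₂ᵢ₊₁-nonempty 5 (s≤s z≤n) (≤-trans (m≤m+n 6 _) 7≤n))) z∈
      (no ¬R₁) →
        let (m , m′ , m≢m′ , m∈ , m′∈) = card>1⇒two-members (R₁-empty⇒∣M₃∣>1 (¬nonempty⇒Empty ¬R₁))
        in co-bridge-via-M₃ h₂∈ m∈ m′∈ m≢m′ (Xh⊆X h₈∈)
             (∪ᵥ-introˡ (X 12) (X 15) (Xh⊆X h₁₂∈)) (∪ᵥ-introʳ (X 12) (X 15) z∈) (X-disjoint (Xh⊆X h₁₂∈) z∈ λ ())
    where
    h₂∈ = proj₂ (hat-nonempty 1 (s≤s z≤n) (≤-trans (m≤m+n 1 _) 7≤n))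
    h₄∈ = proj₂ (hat-nonempty 2 (s≤s z≤n) (≤-trans (m≤m+n 2 _) 7≤n))
    h₈∈ = proj₂ (hat-nonempty 4 (s≤s z≤n) (≤-trans (m≤m+n 4 _) 7≤n))
    h₁₂∈ = proj₂ (hat-nonempty 6 (s≤s z≤n) (≤-trans (m≤m+n 6 _) 7≤n))

  co-bridge-if-X₁₅-empty : n ≡ 7 → Empty (X 15) → InducedCoBridge G
  co-bridge-if-X₁₅-empty refl ¬X₁₅ = case nonempty? (Rs 1) of λ where
      (yes (r , r∈)) →
        let (m , m′ , m≢m′ , m∈ , m′∈) = card>1⇒two-members (L₂ₙ₊₁-empty⇒∣M₂ₙ₋₁∣>1 ¬L₁₅)
        in co-bridge-via-M₁₃ (proj₂ P7-1) h₁₄∈ m∈ m′∈ m≢m′ (Xh⊆X h₈∈)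
             (∪ᵥ-introˡ (X 1) (X 4) (Rs⊆X r∈)) (∪ᵥ-introʳ (X 1) (X 4) (Xh⊆X h₄∈))
             (X-disjoint (Rs⊆X r∈) (Xh⊆X h₄∈) λ ())
      (no ¬R₁) →
        let (m , m′ , m≢m′ , m∈ , m′∈) = card>1⇒two-members (R₁-empty⇒∣M₃∣>1 (¬nonempty⇒Empty ¬R₁))
            (h , h′ , h≢h′ , h∈ , h′∈) = card>1⇒two-members (proj₂ (P7-3b ¬L₁₅))
        in co-bridge-via-M₃ h₂∈ m∈ m′∈ m≢m′ (Xh⊆X h₈∈)
             (∪ᵥ-introˡ (X 12) (X 15) (Xh⊆X h∈)) (∪ᵥ-introˡ (X 12) (X 15) (Xh⊆X h′∈)) h≢h′
    where
    ¬L₁₅ : Empty (Ls 15)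
    ¬L₁₅ v v∈ = ¬X₁₅ v (Ls⊆X v∈)
    h₂∈ = proj₂ (hat-nonempty 1 (s≤s z≤n) (m≤m+n 1 _))
    h₄∈ = proj₂ (hat-nonempty 2 (s≤s z≤n) (m≤m+n 2 _))
    h₈∈ = proj₂ (hat-nonempty 4 (s≤s z≤n) (m≤m+n 4 _))
    h₁₄∈ = proj₂ (hat-nonempty 7 (s≤s z≤n) ≤-refl)

  long-path-co-bridge : 7 ≤ n → InducedCoBridge G
  long-path-co-bridge 7≤n with nonempty? (X 15)
  ... | yes (z , z∈) = co-bridge-if-X₁₅-nonempty 7≤n z∈
  ... | no ¬X₁₅ = co-bridge-if-X₁₅-empty (≤-antisym n≤7 7≤n) (¬nonempty⇒Empty ¬X₁₅)
    where
    n≤7 : n ≤ 7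
    n≤7 = ≮⇒≥ λ 7<n → ¬X₁₅ (X₂ᵢ₊₁-nonempty 7 (s≤s z≤n) 7<n)

  six-path-co-bridge : n ≡ 6 → SingletonHat 2 → SingletonHat 5 → w ∈ᵥ Rs 3 → InducedCoBridge G
  six-path-co-bridge refl single₂ single₅ w∈ =
    co-bridge-via-R₃ single₂ (proj₂ r₁) w∈ (proj₂ (hat-nonempty 2 (s≤s z≤n) (m≤m+n 2 _)))
      (proj₂ (hat-nonempty 3 (s≤s z≤n) (m≤m+n 3 _))) (Xh⊆X (proj₂ (hat-nonempty 5 (s≤s z≤n) (m≤m+n 5 _))))
      (proj₂ x₁₃)
    where
    r₁ : ∃ (_∈ᵥ Rs 1)
    r₁ = decidable-stable (nonempty? (Rs 1)) λ ¬R₁ →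
      <⇒≢ (proj₂ (P7-3a (¬nonempty⇒Empty ¬R₁))) (sym single₂)
    x₁₃ : ∃ (_∈ᵥ X 13)
    x₁₃ = Product.map₂ Ls⊆X (decidable-stable (nonempty? (Ls 13)) λ ¬L₁₃ →
      <⇒≢ (proj₂ (P7-3b (¬nonempty⇒Empty ¬L₁₃))) (sym single₅))

  six-path-hitting : n ≡ 6 → CoBridgeFree G → ∃ λ S → HittingSet G S × card S ≤ 5
  six-path-hitting refl free with All.all? (λ i → card (Xh (2 * i)) ℕ.≟ 1) (indices 6)
  ... | no ¬all with find (¬All⇒Any¬ (λ i → card (Xh (2 * i)) ℕ.≟ 1) (indices 6) ¬all)
  ...   | j , j∈ , ¬single =
          hats (without j (indices 6)) ,
          hats-without-hitting j (λ m i≡j → ⊥-elim (¬single (subst SingletonHat i≡j (singleton m)))) ,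
          ≤-trans (card-hats (without j (indices 6))) (s≤s⁻¹ (length-without j∈))
  six-path-hitting refl free | yes single with nonempty? (Rs 3)
  ... | yes (w , w∈) = ⊥-elim (induced⇒¬CoBridgeFree (six-path-co-bridge refl single₂ single₅ w∈) free)
    where
    single₂ = All.lookup single (∈-indices (s≤s z≤n) (m≤m+n 2 _))
    single₅ = All.lookup single (∈-indices (s≤s z≤n) (m≤m+n 5 _))
  ... | no ¬R₃ = hats I , hats-without-hitting 2 at-2 , card-hats I
    where
    I = without 2 (indices 6)
    single₃ = All.lookup single (∈-indices (s≤s z≤n) (m≤m+n 3 _))

    neighbour∈hats : v ∈ᵥ neighbours 2 → v ∈ᵥ hats I
    neighbour∈hats v∈ with ∪ᵥ-elim (Rs 3) (Xh 2 ∪ᵥ Xh 6) v∈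
    ... | inj₁ v∈R = ⊥-elim (¬R₃ (_ , v∈R))
    ... | inj₂ v∈H with ∪ᵥ-elim (Xh 2) (Xh 6) v∈H
    ...   | inj₁ v∈₂ = ∈-⋃ᵥ {I = I} hatIfSingleton (here refl) (singleton-hat⊆hatIfSingleton 1 (proj₁ P7-1) v∈₂)
    ...   | inj₂ v∈₆ = ∈-⋃ᵥ {I = I} hatIfSingleton (there (here refl))
                         (singleton-hat⊆hatIfSingleton 3 single₃ v∈₆)
    at-2 : ∀ {a b c} (m : MeetsSingletonHat a b c) → index m ≡ 2 → Meets a b c (hats I)
    at-2 (singleton-hat-at _ _ _ onNbr) refl = meets-mono (neighbours 2) (hats I) neighbour∈hats onNbr

  hitting-set : CoBridgeFree G → ∃ λ S → HittingSet G S × card S ≤ 5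
  hitting-set free with n ℕ.≤? 5 | n ℕ.≟ 6
  ... | yes n≤5 | _ = short-path-hitting n≤5
  ... | no _ | yes n≡6 = six-path-hitting n≡6 free
  ... | no n≰5 | no n≢6 =
        ⊥-elim (induced⇒¬CoBridgeFree (long-path-co-bridge (≤∧≢⇒< (≰⇒> n≰5) (n≢6 ∘ sym))) free)

lemma4p2 : ∀ (N : ℕ) (G : Graph N) → ThreeColorable G → Prismatic G →
           CoBridgeFree G → Prime G →
           ∃ λ (S : VSet N) → HittingSet G S × card S ≤ 5
lemma4p2 N G _ _ free (_ , _ , inj₁ triangle-free) = triangle-free-hitting G triangle-free
lemma4p2 N G _ _ free (_ , _ , inj₂ (inj₁ iso)) = LK33-hitting G iso
lemma4p2 N G _ _ free (_ , _ , inj₂ (inj₂ (_ , _ , _ , _ , gp , _))) = GoodPartition.hitting-set gp free
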